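{- Let $G$ be a simple planar graph with vertex set $T \cup W$ ($T \cap W = \emptyset$, $T\cup W\neq\emptyset$) and minimum degree at least $3$, in which $W$ is a stable set. Then there exists a vertex $t \in T$ of degree at most $10$ that has at most $5$ neighbours in $T$. -}

module Defs where

open import Data.Nat using (ℕ; zero; suc; _+_; _*_)
open import Data.Bool using (Bool; true; false; if_then_else_; _∧_)
open import Data.Fin using (Fin; zero; suc)
open import Data.Product using (Σ; ∃; _×_; _,_)
open import Function using (_∘_; _⇔_)
open import Relation.Binary.PropositionalEquality using (_≡_)

record SimpleGraph (n : ℕ) : Set where
  field
    adj   : Fin n → Fin n → Bool
    sym   : ∀ u v → adj u v ≡ adj v u
    irrefl : ∀ v → adj v v ≡ false
open SimpleGraph public

count : ∀ {n} → (Fin n → Bool) → ℕ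
count {zero}  p = 0
count {suc n} p = (if p zero then 1 else 0) + count (p ∘ suc)

deg : ∀ {n} → SimpleGraph n → Fin n → ℕ
deg G v = count (adj G v)

degIn : ∀ {n} → SimpleGraph n → (Fin n → Bool) → Fin n → ℕ
degIn G S v = count (λ u → adj G v u ∧ S u)

sumF : ∀ {m} → (Fin m → ℕ) → ℕ
sumF {zero}  f = 0
sumF {suc m} f = f zero + sumF (f ∘ suc)

darts : ∀ {n} → SimpleGraph n → ℕ
darts G = sumF (deg G)

isolated : ∀ {n} → SimpleGraph n → ℕ
isolated G = count (λ v → isZero (deg G v))
  where
  isZero : ℕ → Bool
  isZero zero    = true
  isZero (suc _) = false

data Reach {n} (G : SimpleGraph n) : Fin n → Fin n → Set where
  here : ∀ {v} → Reach G v v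
  step : ∀ {u w v} → adj G u w ≡ true → Reach G w v → Reach G u v

iterate : ∀ {A : Set} → (A → A) → ℕ → A → A
iterate f zero    x = x
iterate f (suc k) x = f (iterate f k x)

-- A rotation system assigns to each vertex v a cyclic permutation
-- `rot v` of its neighbourhood N(v).  Darts are ordered pairs (u , v)
-- with uv ∈ E; the face permutation is φ (u , v) = (v , rot v u), and the
-- faces of the embedding are the φ-orbits on darts.  A rotation system
-- describes an embedding of every component into the sphere iff
--   |V| - |E| + #faces + #isolated vertices = 2 · #components,
-- i.e. (multiplying by 2)
--   2|V| + 2·#faces + 2·#isolated = #darts + 4·#components.

face : ∀ {n} → (Fin n → Fin n → Fin n) → Fin n × Fin n → Fin n × Fin n
face rot (u , v) = (v , rot v u)

record RotationSystem {n} (G : SimpleGraph n) : Set where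
  field
    rot     : Fin n → Fin n → Fin n
    rot-nbr : ∀ v u → adj G v u ≡ true → adj G v (rot v u) ≡ true
    rot-inj : ∀ v u u' → adj G v u ≡ true → adj G v u' ≡ true →
              rot v u ≡ rot v u' → u ≡ u'
    rot-cyc : ∀ v u w → adj G v u ≡ true → adj G v w ≡ true →
              ∃ λ k → iterate (rot v) k u ≡ w

-- "there are exactly f faces": a labelling of darts by Fin f whose
-- fibres are exactly the φ-orbits
record FaceCount {n} (G : SimpleGraph n) (R : RotationSystem G) (f : ℕ) : Set where
  field
    label     : Fin n → Fin n → Fin f
    label-sur : ∀ (i : Fin f) → ∃ λ u → ∃ λ v → adj G u v ≡ true × label u v ≡ i
    label-orb : ∀ u v u' v' → adj G u v ≡ true → adj G u' v' ≡ true →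
                (label u v ≡ label u' v') ⇔
                (∃ λ k → iterate (face (RotationSystem.rot R)) k (u , v) ≡ (u' , v'))

record ComponentCount {n} (G : SimpleGraph n) (c : ℕ) : Set where
  field
    comp     : Fin n → Fin c
    comp-sur : ∀ (i : Fin c) → ∃ λ v → comp v ≡ i
    comp-rch : ∀ u v → (comp u ≡ comp v) ⇔ Reach G u v

record Planar {n} (G : SimpleGraph n) : Set where
  field
    rotation   : RotationSystem G
    #faces     : ℕ
    faces      : FaceCount G rotation #faces
    #comps     : ℕ
    comps      : ComponentCount G #comps
    euler      : 2 * n + 2 * #faces + 2 * isolated G ≡ darts G + 4 * #comps

{-# OPTIONS --safe #-}
module Submission where

-- Discharging. Suppose every vertex of T has degree at least 11 or more than five
-- neighbours in T. Along each dart x → y, whose face continues to z = rot y x, send the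
-- charge 2 if y ∈ W, 6 if x, y ∈ T and z ∈ W, and 4 otherwise; each charge is counted
-- once for the face of the dart and once for y. As W is stable, every face receives at
-- least 12. A vertex y ∈ W receives 2 deg y ≤ 6 deg y − 12, and y ∈ T receives
-- 4 deg y + 2 s, where s counts the T-neighbours whose rotation successor lies in W; since
-- s ≤ min(|N(y) ∩ T|, |N(y) ∩ W|) ≤ deg y − 6, this is again at most 6 deg y − 12.
-- Hence 12 #faces + 12 |V| ≤ 6 #darts, whereas Euler's formula gives
-- 12 |V| + 12 #faces = 6 #darts + 24 #components.

open import Defs renaming (sym to adj-sym)
open import Algebra.Properties.CommutativeSemigroup using (x∙yz≈y∙xz)
open import Data.Bool using (Bool; true; false; if_then_else_; _∧_; _∨_; not)
import Data.Bool.Properties as Bool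
open import Data.Fin using (Fin; zero; suc; punchOut)
open import Data.Fin.Properties using (_≟_; suc-injective; punchOut-injective; any?; nonZeroIndex)
open import Data.List as List using ([]; _∷_; upTo)
open import Data.List.Properties using (map-cong; map-cong-local; map-∘)
open import Data.Nat.ListAction using () renaming (sum to sumList)
open import Data.Nat.ListAction.Properties using () renaming (sum-++ to sumList-++)
open import Data.List.Relation.Unary.All as All using ([]; _∷_)
open import Data.List.Relation.Unary.AllPairs using ([]; _∷_)
open import Data.List.Relation.Unary.Unique.Propositional using (Unique)
open import Data.Nat using (ℕ; zero; suc; _+_; _*_; _≤_; _<_; _≥_; z≤n; s≤s; _≤?_; >-nonZero⁻¹)
open import Data.Nat.Properties
  using ( ≤-refl; ≤-trans; +-assoc; +-comm; +-identityʳ; +-mono-≤; +-monoˡ-≤; +-monoʳ-≤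
        ; +-suc; +-cancelˡ-≤; *-monoʳ-≤; *-distribˡ-+; *-distribʳ-+
        ; m≤m+n; m≤n+m; m<m+n; n≤1+n; ≰⇒>; <⇒≱
        ; +-*-semiring; +-commutativeSemigroup; module ≤-Reasoning)
open import Data.Nat.Solver using (module +-*-Solver)
open import Data.Product using (∃; _×_; _,_; proj₁; proj₂; uncurry)
open import Data.Product.Properties using (≡-dec)
open import Function using (_∘_; id; Equivalence)
open import Relation.Nullary using (¬_; yes; no; does)
open import Relation.Nullary.Decidable using (dec-true; _×-dec_)
open import Relation.Nullary.Negation using (contradiction)
open import Relation.Binary.PropositionalEquality
open import Algebra.Properties.Semiring.Sum +-*-semiring
  using (sum; sum-syntax; ∑-comm; ∑-distrib-+; *-distribˡ-sum; sum-cong-≗; sum-replicate-zero)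

sumF≡sum : ∀ {m} (f : Fin m → ℕ) → sumF f ≡ sum f
sumF≡sum {zero}  f = refl
sumF≡sum {suc m} f = cong (f zero +_) (sumF≡sum (f ∘ suc))

sum-mono-≤ : ∀ {m} {f g : Fin m → ℕ} → (∀ i → f i ≤ g i) → sum f ≤ sum g
sum-mono-≤ {zero}  f≤g = z≤n
sum-mono-≤ {suc m} f≤g = +-mono-≤ (f≤g zero) (sum-mono-≤ (f≤g ∘ suc))

sum-const : ∀ m c → ∑[ i < m ] c ≡ m * c
sum-const zero    c = refl
sum-const (suc m) c = cong (c +_) (sum-const m c)

sum-single : ∀ {m} (a : Fin m) c → ∑[ i < m ] (if does (a ≟ i) then c else 0) ≡ c
sum-single {suc m} zero c = trans (cong (c +_) (sum-replicate-zero m)) (+-identityʳ c)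
sum-single (suc a) c = sum-single a c

erase : ∀ {m} → Fin m → (Fin m → ℕ) → Fin m → ℕ
erase a f x = if does (x ≟ a) then 0 else f x

sum-erase : ∀ {m} (f : Fin m → ℕ) a → sum f ≡ f a + sum (erase a f)
sum-erase f zero    = refl
sum-erase f (suc a) = trans (cong (f zero +_) (sum-erase (f ∘ suc) a))
                            (x∙yz≈y∙xz +-commutativeSemigroup (f zero) (f (suc a)) _)

erase² : ∀ {m k} → Fin m → Fin k → (Fin m → Fin k → ℕ) → Fin m → Fin k → ℕ
erase² a b g x = if does (x ≟ a) then erase b (g x) else g x

erase²-≢ : ∀ {m k} (g : Fin m → Fin k → ℕ) {a b x y} →
           (a , b) ≢ (x , y) → erase² a b g x y ≡ g x y
erase²-≢ g {a} {b} {x} {y} ab≢xy with x ≟ a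
... | no _     = refl
... | yes refl with y ≟ b
...   | no _     = refl
...   | yes refl = contradiction refl ab≢xy

∑∑-erase : ∀ {m k} (g : Fin m → Fin k → ℕ) a b →
           ∑[ x < m ] ∑[ y < k ] g x y ≡ g a b + ∑[ x < m ] ∑[ y < k ] erase² a b g x y
∑∑-erase g a b = begin
  sum (λ x → sum (g x))                       ≡⟨ sum-erase (λ x → sum (g x)) a ⟩
  sum (g a) + rest                            ≡⟨ cong (_+ rest) (sum-erase (g a) b) ⟩
  g a b + sum (erase b (g a)) + rest          ≡⟨ +-assoc (g a b) _ rest ⟩
  g a b + (sum (erase b (g a)) + rest)        ≡⟨ cong (g a b +_) erased ⟨
  g a b + sum (λ x → sum (erase² a b g x))    ∎
  where
  open ≡-Reasoning
  rest = sum (erase a (λ x → sum (g x)))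
  same-off-a : erase a (λ x → sum (erase² a b g x)) ≗ erase a (λ x → sum (g x))
  same-off-a x with does (x ≟ a)
  ... | true  = refl
  ... | false = refl
  erased : sum (λ x → sum (erase² a b g x)) ≡ sum (erase b (g a)) + rest
  erased = trans (sum-erase _ a)
    (cong₂ _+_ (cong (λ d → sum (if d then erase b (g a) else g a)) (dec-true (a ≟ a) refl))
               (sum-cong-≗ same-off-a))

∑∑-unique-≤ : ∀ {m k} (g : Fin m → Fin k → ℕ) {ps} → Unique ps →
              sumList (List.map (uncurry g) ps) ≤ ∑[ x < m ] ∑[ y < k ] g x y
∑∑-unique-≤ g [] = z≤n
∑∑-unique-≤ g {(a , b) ∷ ps} (fresh ∷ unique) = begin
  g a b + sumList (List.map (uncurry g) ps)
    ≡⟨ cong (λ qs → g a b + sumList qs) untouched ⟨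
  g a b + sumList (List.map (uncurry (erase² a b g)) ps)
    ≤⟨ +-monoʳ-≤ (g a b) (∑∑-unique-≤ _ unique) ⟩
  g a b + ∑[ x < _ ] ∑[ y < _ ] erase² a b g x y
    ≡⟨ ∑∑-erase g a b ⟨
  ∑[ x < _ ] ∑[ y < _ ] g x y
    ∎
  where
  open ≤-Reasoning
  untouched : List.map (uncurry (erase² a b g)) ps ≡ List.map (uncurry g) ps
  untouched = map-cong-local (All.map (erase²-≢ g) fresh)

indicator : Bool → ℕ
indicator b = if b then 1 else 0

count≡sum : ∀ {n} (p : Fin n → Bool) → count p ≡ ∑[ x < n ] indicator (p x)
count≡sum {zero}  p = refl
count≡sum {suc n} p = cong (indicator (p zero) +_) (count≡sum (p ∘ suc))

positive-count : ∀ {n} {p : Fin n → Bool} {k} → count p ≡ suc k → ∃ λ x → p x ≡ true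
positive-count {zero} ()
positive-count {suc n} {p} eq with p zero in p₀
... | true  = zero , p₀
... | false with x , px ← positive-count eq = suc x , px

count-∧-split : ∀ {n} (p q : Fin n → Bool) →
                count p ≡ count (λ x → p x ∧ q x) + count (λ x → p x ∧ not (q x))
count-∧-split {zero}  p q = refl
count-∧-split {suc n} p q with p zero | q zero
... | false | _     = count-∧-split (p ∘ suc) (q ∘ suc)
... | true  | true  = cong suc (count-∧-split (p ∘ suc) (q ∘ suc))
... | true  | false = trans (cong suc (count-∧-split (p ∘ suc) (q ∘ suc))) (sym (+-suc _ _))

count-≤-Fin : ∀ {n m} (p : Fin n → Bool) (ι : ∀ x → p x ≡ true → Fin m) →
              (∀ x y px py → ι x px ≡ ι y py → x ≡ y) → count p ≤ m
count-≤-Fin {zero} p ι ι-inj = z≤n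
count-≤-Fin {suc n} p ι ι-inj with p zero in p₀
... | false =
  count-≤-Fin (p ∘ suc) (λ x → ι (suc x)) (λ x y px py → suc-injective ∘ ι-inj _ _ px py)
count-≤-Fin {suc n} {zero}  p ι ι-inj | true with () ← ι zero p₀
count-≤-Fin {suc n} {suc m} p ι ι-inj | true =
  s≤s (count-≤-Fin (p ∘ suc) (λ x px → punchOut (ι₀≢ x px))
        (λ x y px py → suc-injective ∘ ι-inj _ _ px py
                       ∘ punchOut-injective (ι₀≢ x px) (ι₀≢ y py)))
  where
  ι₀≢ : ∀ x px → ι zero p₀ ≢ ι (suc x) px
  ι₀≢ x px eq with () ← ι-inj zero (suc x) p₀ px eq

fzero-if : ∀ {b k} → b ≡ true → Fin (indicator b + k)
fzero-if refl = zero

fsuc-if : ∀ b {k} → Fin k → Fin (indicator b + k)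
fsuc-if true  i = suc i
fsuc-if false i = i

fzero-if≢fsuc-if : ∀ {b k} (b≡true : b ≡ true) (i : Fin k) → fzero-if b≡true ≢ fsuc-if b i
fzero-if≢fsuc-if refl i ()

fsuc-if-injective : ∀ b {k} {i j : Fin k} → fsuc-if b i ≡ fsuc-if b j → i ≡ j
fsuc-if-injective true  = suc-injective
fsuc-if-injective false = id

rank : ∀ {n} (q : Fin n → Bool) x → q x ≡ true → Fin (count q)
rank q zero    qx = fzero-if qx
rank q (suc x) qx = fsuc-if (q zero) (rank (q ∘ suc) x qx)

rank-injective : ∀ {n} (q : Fin n → Bool) x y qx qy → rank q x qx ≡ rank q y qy → x ≡ y
rank-injective q zero    zero    qx qy eq = refl
rank-injective q zero    (suc y) qx qy eq = contradiction eq (fzero-if≢fsuc-if qx _)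
rank-injective q (suc x) zero    qx qy eq = contradiction (sym eq) (fzero-if≢fsuc-if qy _)
rank-injective q (suc x) (suc y) qx qy eq =
  cong suc (rank-injective (q ∘ suc) x y qx qy (fsuc-if-injective (q zero) eq))

count-≤-injection : ∀ {n m} (p : Fin n → Bool) (q : Fin m → Bool) (f : Fin n → Fin m) →
                    (∀ x → p x ≡ true → q (f x) ≡ true) →
                    (∀ x y → p x ≡ true → p y ≡ true → f x ≡ f y → x ≡ y) →
                    count p ≤ count q
count-≤-injection p q f p⇒q f-inj =
  count-≤-Fin p (λ x px → rank q (f x) (p⇒q x px))
    (λ x y px py → f-inj x y px py ∘ rank-injective q (f x) (f y) (p⇒q x px) (p⇒q y py))

iterate-fixed : ∀ {A : Set} {f : A → A} {x} → f x ≡ x → ∀ k → iterate f k x ≡ x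
iterate-fixed fx≡x zero    = refl
iterate-fixed {f = f} fx≡x (suc k) = trans (cong f (iterate-fixed fx≡x k)) fx≡x

adj⇒≢ : ∀ {n} (G : SimpleGraph n) {x y} → adj G x y ≡ true → x ≢ y
adj⇒≢ G {x} xy refl with () ← trans (sym xy) (irrefl G x)

module _ {n} {G : SimpleGraph n} (R : RotationSystem G) where
  open RotationSystem R

  IsDart : Fin n × Fin n → Set
  IsDart (x , y) = adj G x y ≡ true

  face-dart : ∀ {e} → IsDart e → IsDart (face rot e)
  face-dart {x , y} xy = rot-nbr y x (trans (adj-sym G y x) xy)

  iterate-face-dart : ∀ k {e} → IsDart e → IsDart (iterate (face rot) k e)
  iterate-face-dart zero    e = e
  iterate-face-dart (suc k) e = face-dart (iterate-face-dart k e)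

  face-≢ : ∀ {e} → IsDart e → face rot e ≢ e
  face-≢ {x , y} xy eq = adj⇒≢ G xy (sym (cong proj₁ eq))

  -- Two face steps return to (x , y) only if rot y x ≡ x, which makes x the only neighbour of y.
  face²-≢ : ∀ {e} → IsDart e → 2 ≤ deg G (proj₂ e) → face rot (face rot e) ≢ e
  face²-≢ {x , y} xy deg≥2 eq = contradiction deg≥2 (<⇒≱ (s≤s deg≤1))
    where
    yx = trans (adj-sym G y x) xy
    only-x : ∀ w → adj G y w ≡ true → w ≡ x
    only-x w yw with k , rotᵏx≡w ← rot-cyc y x w yx yw =
      trans (sym rotᵏx≡w) (iterate-fixed (cong proj₁ eq) k)
    deg≤1 : deg G y ≤ 1
    deg≤1 = count-≤-Fin (adj G y) (λ _ _ → zero)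
              (λ w w' yw yw' _ → trans (only-x w yw) (sym (only-x w' yw')))

-- weight (x ∈ T) (y ∈ T) (z ∈ T) is the charge of a dart x → y followed on its face by y → z.
weight : Bool → Bool → Bool → ℕ
weight p false r = 2
weight p true  r = 4 + (if p ∧ not r then 2 else 0)

2≤weight : ∀ p q r → 2 ≤ weight p q r
2≤weight p false r = ≤-refl
2≤weight p true  r = m≤m+n 2 _

4≤weight : ∀ p r → 4 ≤ weight p true r
4≤weight p r = m≤m+n 4 (if p ∧ not r then 2 else 0)

consecutive-weight : ∀ p q r s → (q ∨ r) ≡ true →
                     6 ≤ sumList (weight p q r ∷ weight q r s ∷ [])
consecutive-weight p true  r    s _ = +-mono-≤ (4≤weight p r) (+-monoˡ-≤ 0 (2≤weight true r s))
consecutive-weight p false true s _ = ≤-refl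

triangle-weight : ∀ a b c → (a ∨ b) ≡ true → (b ∨ c) ≡ true → (c ∨ a) ≡ true →
                  12 ≤ sumList (weight a b c ∷ weight b c a ∷ weight c a b ∷ [])
triangle-weight true  true  true  _ _ _ = ≤-refl
triangle-weight true  true  false _ _ _ = ≤-refl
triangle-weight true  false true  _ _ _ = ≤-refl
triangle-weight false true  true  _ _ _ = ≤-refl
triangle-weight true  false false _ () _
triangle-weight false true  false _ _ ()
triangle-weight false false _     () _ _

walkWeight : (ℕ → Bool) → ℕ → ℕ
walkWeight t k = weight (t k) (t (1 + k)) (t (2 + k))

walk₄-weight : ∀ t → (∀ k → (t k ∨ t (suc k)) ≡ true) →
                   12 ≤ sumList (List.map (walkWeight t) (upTo 4))
walk₄-weight t meets-T =
  subst (12 ≤_) (sym (sumList-++ (walkWeight t 0 ∷ walkWeight t 1 ∷ [])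
                                 (walkWeight t 2 ∷ walkWeight t 3 ∷ [])))
    (+-mono-≤ (consecutive-weight (t 0) (t 1) (t 2) (t 3) (meets-T 1))
              (consecutive-weight (t 2) (t 3) (t 4) (t 5) (meets-T 3)))

closed-walk₃-weight : ∀ t → (∀ k → (t k ∨ t (suc k)) ≡ true) → t 3 ≡ t 0 → t 4 ≡ t 1 →
                     12 ≤ sumList (List.map (walkWeight t) (upTo 3))
closed-walk₃-weight t meets-T t₃≡t₀ t₄≡t₁ rewrite t₃≡t₀ | t₄≡t₁ =
  triangle-weight (t 0) (t 1) (t 2) (meets-T 0) (meets-T 1)
                  (subst (λ b → (t 2 ∨ b) ≡ true) t₃≡t₀ (meets-T 2))

3≤d⇒2d+12≤6d : ∀ {d} → 3 ≤ d → 2 * d + 12 ≤ 6 * d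
3≤d⇒2d+12≤6d {d} 3≤d =
  subst (2 * d + 12 ≤_) (sym (*-distribʳ-+ d 2 4)) (+-monoʳ-≤ (2 * d) (*-monoʳ-≤ 4 3≤d))

s+6≤d⇒4d+2s+12≤6d : ∀ {d s} → s + 6 ≤ d → 4 * d + 2 * s + 12 ≤ 6 * d
s+6≤d⇒4d+2s+12≤6d {d} {s} s+6≤d = begin
  4 * d + 2 * s + 12    ≡⟨ +-assoc (4 * d) (2 * s) 12 ⟩
  4 * d + (2 * s + 12)  ≡⟨ cong (4 * d +_) (*-distribˡ-+ 2 s 6) ⟨
  4 * d + 2 * (s + 6)   ≤⟨ +-monoʳ-≤ (4 * d) (*-monoʳ-≤ 2 s+6≤d) ⟩
  4 * d + 2 * d         ≡⟨ *-distribʳ-+ d 4 2 ⟨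
  6 * d                 ∎
  where open ≤-Reasoning

-- Either dT ≥ 6, or dT ≤ 5 and dT + dW ≥ 11, whence dW ≥ 6.
split-degree-bound : ∀ {dT dW s} → s ≤ dT → s ≤ dW → ¬ (dT + dW ≤ 10 × dT ≤ 5) →
                     s + 6 ≤ dT + dW
split-degree-bound {dT} {dW} {s} s≤dT s≤dW not-small with dT ≤? 5
... | no dT≰5 = subst (s + 6 ≤_) (+-comm dW dT) (+-mono-≤ s≤dW (≰⇒> dT≰5))
... | yes dT≤5 with dT + dW ≤? 10
...   | yes d≤10 = contradiction (d≤10 , dT≤5) not-small
...   | no d≰10  =
  +-mono-≤ s≤dT (+-cancelˡ-≤ 5 6 dW (≤-trans (≰⇒> d≰10) (+-monoˡ-≤ dW dT≤5)))

module Discharging {n} (G : SimpleGraph n) (P : Planar G) (inT : Fin n → Bool) where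
  open Planar P
  open RotationSystem rotation
  open FaceCount faces

  Small : Fin n → Set
  Small y = deg G y ≤ 10 × degIn G inT y ≤ 5

  EdgesMeetT : Set
  EdgesMeetT = ∀ u v → adj G u v ≡ true → (inT u ∨ inT v) ≡ true

  charge : Fin n → Fin n → ℕ
  charge x y = if adj G x y then weight (inT x) (inT y) (inT (rot y x)) else 0

  total : ℕ
  total = ∑[ x < n ] ∑[ y < n ] charge x y

  faceCharge : Fin #faces → Fin n → Fin n → ℕ
  faceCharge i x y = if does (label x y ≟ i) then charge x y else 0

  total-by-faces : total ≡ ∑[ i < #faces ] ∑[ x < n ] ∑[ y < n ] faceCharge i x y
  total-by-faces =
    trans (sum-cong-≗ λ x → trans (sum-cong-≗ λ y → sym (sum-single (label x y) (charge x y)))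
                                  (∑-comm (λ y i → faceCharge i x y)))
          (∑-comm (λ x i → sum (faceCharge i x)))

  face-charge-≥12 : (∀ v → 2 ≤ deg G v) → EdgesMeetT → ∀ i → 12 ≤ ∑[ x < n ] ∑[ y < n ] faceCharge i x y
  face-charge-≥12 deg≥2 edges-meet-T i with u , v , uv , uv∈i ← label-sur i = bound
    where
    dart : ℕ → Fin n × Fin n
    dart k = iterate (face rot) k (u , v)

    colour : ℕ → Bool
    colour k = inT (proj₁ (dart k))

    is-dart : ∀ k → IsDart rotation (dart k)
    is-dart k = iterate-face-dart rotation k uv

    in-face : ∀ k → label (proj₁ (dart k)) (proj₂ (dart k)) ≡ i
    in-face k = trans (sym (Equivalence.from (label-orb u v _ _ uv (is-dart k)) (k , refl))) uv∈i

    dart-charge : ∀ k → uncurry (faceCharge i) (dart k) ≡ walkWeight colour k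
    dart-charge k rewrite in-face k | dec-true (i ≟ i) refl | is-dart k = refl

    walk-bound : ∀ ks → Unique (List.map dart ks) →
                 sumList (List.map (walkWeight colour) ks) ≤ ∑[ x < n ] ∑[ y < n ] faceCharge i x y
    walk-bound ks unique =
      subst (_≤ _) (cong sumList (trans (sym (map-∘ ks)) (map-cong dart-charge ks)))
        (∑∑-unique-≤ (faceCharge i) unique)

    step-≢ : ∀ k → dart k ≢ dart (1 + k)
    step-≢ k = ≢-sym (face-≢ rotation (is-dart k))

    two-steps-≢ : ∀ k → dart k ≢ dart (2 + k)
    two-steps-≢ k = ≢-sym (face²-≢ rotation (is-dart k) (deg≥2 _))

    meets-T : ∀ k → (colour k ∨ colour (suc k)) ≡ true
    meets-T k = edges-meet-T _ _ (is-dart k)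

    distinct₃ : Unique (List.map dart (upTo 3))
    distinct₃ = (step-≢ 0 ∷ two-steps-≢ 0 ∷ []) ∷ (step-≢ 1 ∷ []) ∷ [] ∷ []

    distinct₄ : dart 0 ≢ dart 3 → Unique (List.map dart (upTo 4))
    distinct₄ 0≢3 = (step-≢ 0 ∷ two-steps-≢ 0 ∷ 0≢3 ∷ [])
                  ∷ (step-≢ 1 ∷ two-steps-≢ 1 ∷ []) ∷ (step-≢ 2 ∷ []) ∷ [] ∷ []

    -- The face either closes up after three darts, or its first four darts are distinct.
    bound : 12 ≤ ∑[ x < n ] ∑[ y < n ] faceCharge i x y
    bound with ≡-dec _≟_ _≟_ (dart 3) (dart 0)
    ... | yes closed = ≤-trans (closed-walk₃-weight colour meets-T (cong (inT ∘ proj₁) closed)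
                                                                  (cong (inT ∘ proj₂) closed))
                               (walk-bound (upTo 3) distinct₃)
    ... | no  open₄  = ≤-trans (walk₄-weight colour meets-T)
                               (walk-bound (upTo 4) (distinct₄ (≢-sym open₄)))

  inflow : Fin n → ℕ
  inflow y = ∑[ x < n ] charge x y

  switch : Fin n → Fin n → Bool
  switch y x = (adj G y x ∧ inT x) ∧ not (inT (rot y x))

  inflow-W : ∀ y → inT y ≡ false → inflow y ≡ 2 * deg G y
  inflow-W y y∉T = begin
    inflow y                                     ≡⟨ sum-cong-≗ charge≡ ⟩
    ∑[ x < n ] (2 * indicator (adj G y x))       ≡⟨ *-distribˡ-sum 2 (indicator ∘ adj G y) ⟨
    2 * ∑[ x < n ] indicator (adj G y x)         ≡⟨ cong (2 *_) (count≡sum (adj G y)) ⟨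
    2 * deg G y                                  ∎
    where
    open ≡-Reasoning
    charge≡ : ∀ x → charge x y ≡ 2 * indicator (adj G y x)
    charge≡ x rewrite adj-sym G x y | y∉T with adj G y x
    ... | true  = refl
    ... | false = refl

  inflow-T : ∀ y → inT y ≡ true → inflow y ≡ 4 * deg G y + 2 * count (switch y)
  inflow-T y y∈T = begin
    inflow y                                          ≡⟨ sum-cong-≗ charge≡ ⟩
    ∑[ x < n ] (4 * neighbour x + 2 * switches x)
      ≡⟨ ∑-distrib-+ ((4 *_) ∘ neighbour) ((2 *_) ∘ switches) ⟩
    ∑[ x < n ] (4 * neighbour x) + ∑[ x < n ] (2 * switches x)
      ≡⟨ cong₂ _+_ (*-distribˡ-sum 4 neighbour) (*-distribˡ-sum 2 switches) ⟨
    4 * sum neighbour + 2 * sum switches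
      ≡⟨ cong₂ (λ a b → 4 * a + 2 * b) (count≡sum (adj G y)) (count≡sum (switch y)) ⟨
    4 * deg G y + 2 * count (switch y)                ∎
    where
    open ≡-Reasoning
    neighbour switches : Fin n → ℕ
    neighbour = indicator ∘ adj G y
    switches  = indicator ∘ switch y
    charge≡ : ∀ x → charge x y ≡ 4 * neighbour x + 2 * switches x
    charge≡ x rewrite adj-sym G x y | y∈T with adj G y x | inT x | inT (rot y x)
    ... | true  | true  | true  = refl
    ... | true  | true  | false = refl
    ... | true  | false | _     = refl
    ... | false | _     | _     = refl

  switch-bound : ∀ y → ¬ Small y → count (switch y) + 6 ≤ deg G y
  switch-bound y not-small =
    subst (count (switch y) + 6 ≤_) (sym deg≡)
      (split-degree-bound ≤degIn ≤degW (subst (λ d → ¬ (d ≤ 10 × degIn G inT y ≤ 5)) deg≡ not-small))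
    where
    deg≡ : deg G y ≡ degIn G inT y + count (λ x → adj G y x ∧ not (inT x))
    deg≡ = count-∧-split (adj G y) inT
    ≤degIn : count (switch y) ≤ degIn G inT y
    ≤degIn = subst (count (switch y) ≤_)
                   (sym (count-∧-split (λ x → adj G y x ∧ inT x) (inT ∘ rot y))) (m≤n+m _ _)
    switch⇒adj : ∀ x → switch y x ≡ true → adj G y x ≡ true
    switch⇒adj x s with adj G y x
    ... | true = refl
    switch⇒next∉T : ∀ x → switch y x ≡ true → (adj G y (rot y x) ∧ not (inT (rot y x))) ≡ true
    switch⇒next∉T x s with adj G y x in yx | inT x | inT (rot y x)
    ... | true | true | false = cong (_∧ true) (rot-nbr y x yx)
    ≤degW : count (switch y) ≤ count (λ x → adj G y x ∧ not (inT x))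
    ≤degW = count-≤-injection (switch y) _ (rot y) switch⇒next∉T
              (λ x x' s s' → rot-inj y x x' (switch⇒adj x s) (switch⇒adj x' s'))

  inflow-bound : ∀ y → 3 ≤ deg G y → (inT y ≡ true → ¬ Small y) → inflow y + 12 ≤ 6 * deg G y
  inflow-bound y deg≥3 large with inT y Bool.≟ true
  ... | no  y∉T = subst (λ c → c + 12 ≤ 6 * deg G y) (sym (inflow-W y (Bool.¬-not y∉T)))
                    (3≤d⇒2d+12≤6d deg≥3)
  ... | yes y∈T = subst (λ c → c + 12 ≤ 6 * deg G y) (sym (inflow-T y y∈T))
                    (s+6≤d⇒4d+2s+12≤6d (switch-bound y (large y∈T)))

  faces-bound : (∀ v → 2 ≤ deg G v) → EdgesMeetT → #faces * 12 ≤ total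
  faces-bound deg≥2 meets-T = begin
    #faces * 12                                              ≡⟨ sum-const #faces 12 ⟨
    ∑[ i < #faces ] 12                                       ≤⟨ sum-mono-≤ (face-charge-≥12 deg≥2 meets-T) ⟩
    ∑[ i < #faces ] ∑[ x < n ] ∑[ y < n ] faceCharge i x y   ≡⟨ total-by-faces ⟨
    total                                                    ∎
    where open ≤-Reasoning

  vertices-bound : (∀ v → 3 ≤ deg G v) → (∀ y → inT y ≡ true → ¬ Small y) →
                   total + n * 12 ≤ 6 * darts G
  vertices-bound deg≥3 large = begin
    total + n * 12                       ≡⟨ cong₂ _+_ (∑-comm charge) (sym (sum-const n 12)) ⟩
    ∑[ y < n ] inflow y + ∑[ y < n ] 12  ≡⟨ ∑-distrib-+ inflow (λ _ → 12) ⟨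
    ∑[ y < n ] (inflow y + 12)           ≤⟨ sum-mono-≤ (λ y → inflow-bound y (deg≥3 y) (large y)) ⟩
    ∑[ y < n ] (6 * deg G y)             ≡⟨ *-distribˡ-sum 6 (deg G) ⟨
    6 * sum (deg G)                      ≡⟨ cong (6 *_) (sumF≡sum (deg G)) ⟨
    6 * darts G                          ∎
    where open ≤-Reasoning

stable-complement-covers : ∀ {n} (G : SimpleGraph n) (c : Fin n → Bool) →
                           (∀ u v → c u ≡ false → c v ≡ false → adj G u v ≡ false) →
                           ∀ u v → adj G u v ≡ true → (c u ∨ c v) ≡ true
stable-complement-covers G c stable u v uv with c u in cu | c v in cv
... | true  | _    = refl
... | false | true = refl
... | false | false with () ← trans (sym uv) (stable u v cu cv)

no-isolated : ∀ {n} (G : SimpleGraph n) → (∀ v → 1 ≤ deg G v) → isolated G ≡ 0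
no-isolated G deg≥1 with isolated G in eq
... | zero  = refl
... | suc k with v , isZero≡true ← positive-count eq with count (adj G v) | isZero≡true | deg≥1 v
...   | suc _ | () | _

euler-charge-bound : ∀ {m} (G : SimpleGraph (suc m)) (P : Planar G) → (∀ v → 1 ≤ deg G v) →
                     6 * darts G < Planar.#faces P * 12 + suc m * 12
euler-charge-bound {m} G P deg≥1 = begin-strict
  6 * darts G                                    <⟨ m<m+n (6 * darts G) 24·#comps>0 ⟩
  6 * darts G + 6 * (4 * #comps)                 ≡⟨ *-distribˡ-+ 6 (darts G) (4 * #comps) ⟨
  6 * (darts G + 4 * #comps)                     ≡⟨ cong (6 *_) euler ⟨
  6 * (2 * suc m + 2 * #faces + 2 * isolated G)  ≡⟨ cong (λ i → 6 * (2 * suc m + 2 * #faces + 2 * i))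
                                                         (no-isolated G deg≥1) ⟩
  6 * (2 * suc m + 2 * #faces + 2 * 0)           ≡⟨ solve 2 (λ v f → con 6 :* (con 2 :* v :+ con 2 :* f :+ con 0)
                                                                     := f :* con 12 :+ v :* con 12)
                                                           refl (suc m) #faces ⟩
  #faces * 12 + suc m * 12                       ∎
  where
  open Planar P
  open ComponentCount comps
  open ≤-Reasoning
  open +-*-Solver
  24·#comps>0 : 0 < 6 * (4 * #comps)
  24·#comps>0 = ≤-trans (s≤s z≤n) (*-monoʳ-≤ 6 (*-monoʳ-≤ 4 #comps>0))
    where #comps>0 = >-nonZero⁻¹ #comps {{nonZeroIndex (comp zero)}}

lemma5 : ∀ (n : ℕ) (G : SimpleGraph n) (inT : Fin n → Bool) →
         n ≥ 1 →
         Planar G →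
         (∀ v → deg G v ≥ 3) →
         (∀ u v → inT u ≡ false → inT v ≡ false → adj G u v ≡ false) →
         ∃ λ t → inT t ≡ true × deg G t ≤ 10 × degIn G inT t ≤ 5
lemma5 zero    _ _   () _ _ _
lemma5 (suc m) G inT _  P deg≥3 W-stable
  with any? (λ t → (inT t Bool.≟ true) ×-dec (deg G t ≤? 10) ×-dec (degIn G inT t ≤? 5))
... | yes found = found
... | no  none  = contradiction charge-bounds (<⇒≱ (euler-charge-bound G P (≤-trans (s≤s z≤n) ∘ deg≥3)))
  where
  open Discharging G P inT
  charge-bounds : Planar.#faces P * 12 + suc m * 12 ≤ 6 * darts G
  charge-bounds =
    ≤-trans (+-monoˡ-≤ (suc m * 12)
                       (faces-bound (≤-trans (n≤1+n 2) ∘ deg≥3) (stable-complement-covers G inT W-stable)))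
            (vertices-bound deg≥3 (λ t t∈T small → none (t , t∈T , small)))
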